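{- Let $G$ be the niche graph of a bipartite tournament $D$ with bipartition $(U,V)$, and let $Z$ be a set consisting of exactly one representative of each equivalence class of $\equiv_D$. Then each component of the induced subgraph $G[Z]$ is a complete multipartite graph whose partite sets have size at most two.
   Context: A bipartite tournament is an orientation of a complete bipartite graph. The niche graph of a digraph $D$ is the simple graph with vertex set $V(D)$ in which distinct $u,v$ are adjacent iff there is a vertex $w$ with $(u,w),(v,w)\in A(D)$, or with $(w,u),(w,v)\in A(D)$. The equivalence relation $\equiv_D$ on $V(D)$ is defined by $u\equiv_D v$ iff $N^+_D(u)=N^+_D(v)$, where $N^+_D$ denotes out-neighborhood. -}

module Defs where

open import Data.Nat using (ℕ)
open import Data.Bool using (Bool; true; false)
open import Data.Fin using (Fin)
open import Data.Fin.Subset using (Subset; _∈_)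
open import Data.Product using (Σ; ∃; _×_; _,_)
open import Data.Sum using (_⊎_)
open import Relation.Nullary using (¬_)
open import Relation.Binary.PropositionalEquality using (_≡_; _≢_)
open import Function.Bundles using (_⇔_)

Digraph : ℕ → Set
Digraph n = Fin n → Fin n → Bool

Arc : ∀ {n} → Digraph n → Fin n → Fin n → Set
Arc D u v = D u v ≡ true

-- D is a bipartite tournament with bipartition (U , V), where
-- U = { v | side v ≡ true } and V = { v | side v ≡ false }:
-- an orientation of the complete bipartite graph K_{U,V}.
record IsBipartiteTournament {n : ℕ} (D : Digraph n) (side : Fin n → Bool) : Set where
  field
    noArcWithin : ∀ u v → side u ≡ side v → ¬ Arc D u v
    oneArcAcross : ∀ u v → side u ≢ side v →
      (Arc D u v × ¬ Arc D v u) ⊎ (Arc D v u × ¬ Arc D u v)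

NicheAdj : ∀ {n} → Digraph n → Fin n → Fin n → Set
NicheAdj D u v =
  u ≢ v × ∃ λ w → (Arc D u w × Arc D v w) ⊎ (Arc D w u × Arc D w v)

OutEquiv : ∀ {n} → Digraph n → Fin n → Fin n → Set
OutEquiv D u v = ∀ w → (Arc D u w ⇔ Arc D v w)

IsTransversal : ∀ {n} → Digraph n → Subset n → Set
IsTransversal D Z =
  (∀ u → ∃ λ z → z ∈ Z × OutEquiv D z u) ×
  (∀ z z' → z ∈ Z → z' ∈ Z → OutEquiv D z z' → z ≡ z')

data Reach {n} (Adj : Fin n → Fin n → Set) (Z : Subset n) (x : Fin n) : Fin n → Set where
  here : Reach Adj Z x x
  step : ∀ {y y'} → Reach Adj Z x y → y' ∈ Z → Adj y y' → Reach Adj Z x y'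

-- The subgraph of Adj induced on the vertex set C is complete multipartite
-- with all partite sets of size at most two: there is a labelling f of the
-- vertices (label = partite set) such that two distinct vertices of C are
-- adjacent iff they lie in different partite sets, and no partite set
-- contains three distinct vertices of C.
IsCompleteMultipartite≤2 : ∀ {n} → (Fin n → Fin n → Set) → (Fin n → Set) → Set
IsCompleteMultipartite≤2 {n} Adj C =
  Σ (Fin n → ℕ) λ f →
    (∀ x y → C x → C y → x ≢ y → (Adj x y ⇔ f x ≢ f y)) ×
    (∀ x y z → C x → C y → C z → f x ≡ f y → f y ≡ f z →
       x ≡ y ⊎ y ≡ z ⊎ x ≡ z)

-- All vertices of a component of G[Z] lie in one part of the bipartition, and
-- for two vertices x, y of the same part, nonadjacency in the niche graph says
-- exactly that y is a complement of x: its out-neighbourhood is the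
-- in-neighbourhood of x. Complements are unique up to ≡_D, so inside Z every
-- vertex has at most one complement, and labelling each vertex by the smaller
-- index of itself and its complement in Z exhibits the partite sets.
module Submission where

open import Defs
open import Data.Nat using (ℕ; _⊓_)
open import Data.Nat.Properties using (⊓-comm; ⊓-sel)
open import Data.Fin using (Fin; toℕ)
open import Data.Fin.Properties using (toℕ-injective; any?; all?; ¬∀⟶∃¬) renaming (_≟_ to _≟ᶠ_)
open import Data.Bool using (Bool; true; false; not)
open import Data.Bool.Properties using (not-involutive; ¬-not) renaming (_≟_ to _≟ᵇ_)
open import Data.Fin.Subset using (Subset; _∈_)
open import Data.Fin.Subset.Properties using (_∈?_)
open import Data.Product using (_×_; _,_; ∃-syntax)
open import Data.Sum using (_⊎_; inj₁; inj₂)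
open import Relation.Nullary using (¬_; Dec; yes; no; contradiction)
open import Relation.Nullary.Decidable using (_×-dec_)
open import Relation.Binary.PropositionalEquality
open import Function.Base using (_∘_)
open import Function.Bundles using (_⇔_; mk⇔)

module _ {n : ℕ} (D : Digraph n) where

  Complement : Fin n → Fin n → Set
  Complement x y = ∀ w → D y w ≡ D w x

  complement? : ∀ x y → Dec (Complement x y)
  complement? x y = all? (λ w → D y w ≟ᵇ D w x)

  outEquiv-pointwise : ∀ {x y} → (∀ w → D x w ≡ D y w) → OutEquiv D x y
  outEquiv-pointwise x≗y w = mk⇔ (trans (sym (x≗y w))) (trans (x≗y w))

  complement-unique : ∀ {x y y'} → Complement x y → Complement x y' → OutEquiv D y y'
  complement-unique c c' = outEquiv-pointwise (λ w → trans (c w) (sym (c' w)))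

module BipartiteTournament {n : ℕ} {D : Digraph n} {side : Fin n → Bool}
                           (BT : IsBipartiteTournament D side) where
  open IsBipartiteTournament BT

  arc-within : ∀ {u v} → side u ≡ side v → D u v ≡ false
  arc-within {u} {v} s = ¬-not (noArcWithin u v s)

  arc-across : ∀ {u v} → side u ≢ side v → D u v ≡ not (D v u)
  arc-across {u} {v} s with oneArcAcross u v s
  ... | inj₁ (uv , ¬vu) rewrite uv | ¬-not ¬vu = refl
  ... | inj₂ (vu , ¬uv) rewrite vu | ¬-not ¬uv = refl

  arc-asym : ∀ {u v} → Arc D u v → ¬ Arc D v u
  arc-asym {u} {v} uv vu with side u ≟ᵇ side v
  ... | yes s = noArcWithin u v s uv
  ... | no s = contradiction (trans (sym uv) (trans (arc-across s) (cong not vu))) λ ()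

  nicheAdj⇒sameSide : ∀ {x y} → NicheAdj D x y → side x ≡ side y
  nicheAdj⇒sameSide {x} {y} (_ , w , inj₁ (xw , yw)) =
    trans (¬-not (λ s → noArcWithin x w s xw)) (sym (¬-not (λ s → noArcWithin y w s yw)))
  nicheAdj⇒sameSide {x} {y} (_ , w , inj₂ (wx , wy)) =
    trans (¬-not (λ s → noArcWithin w x (sym s) wx)) (sym (¬-not (λ s → noArcWithin w y (sym s) wy)))

  reach⇒sameSide : ∀ {Z x y} → Reach (NicheAdj D) Z x y → side y ≡ side x
  reach⇒sameSide here = refl
  reach⇒sameSide (step r _ adj) = trans (sym (nicheAdj⇒sameSide adj)) (reach⇒sameSide r)

  module _ {x y : Fin n} (s : side x ≡ side y) where

    sameIn⇒outEquiv : (∀ w → D w x ≡ D w y) → OutEquiv D x y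
    sameIn⇒outEquiv in-eq = outEquiv-pointwise D out-eq
      where
      out-eq : ∀ w → D x w ≡ D y w
      out-eq w with side w ≟ᵇ side x
      ... | yes e = trans (arc-within (sym e)) (sym (arc-within (trans (sym s) (sym e))))
      ... | no e = begin
        D x w       ≡⟨ arc-across (e ∘ sym) ⟩
        not (D w x) ≡⟨ cong not (in-eq w) ⟩
        not (D w y) ≡⟨ arc-across (e ∘ sym ∘ trans s) ⟨
        D y w       ∎
        where open ≡-Reasoning

    complement-sym : Complement D x y → Complement D y x
    complement-sym c w with side w ≟ᵇ side x
    ... | yes e = trans (arc-within (sym e)) (sym (arc-within (trans e s)))
    ... | no e = begin
      D x w             ≡⟨ arc-across (e ∘ sym) ⟩
      not (D w x)       ≡⟨ cong not (c w) ⟨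
      not (D y w)       ≡⟨ cong not (arc-across (e ∘ sym ∘ trans s)) ⟩
      not (not (D w y)) ≡⟨ not-involutive _ ⟩
      D w y             ∎
      where open ≡-Reasoning

    complement⇒¬nicheAdj : Complement D x y → ¬ NicheAdj D x y
    complement⇒¬nicheAdj c (_ , w , inj₁ (xw , yw)) = arc-asym xw (trans (sym (c w)) yw)
    complement⇒¬nicheAdj c (_ , w , inj₂ (wx , wy)) = arc-asym (trans (complement-sym c w) wy) wx

    -- A witness w of non-complementarity lies across the bipartition, so either
    -- y → w ← x or y ← w → x.
    ¬complement⇒nicheAdj : x ≢ y → ¬ Complement D x y → NicheAdj D x y
    ¬complement⇒nicheAdj x≢y ¬c with ¬∀⟶∃¬ n _ (λ w → D y w ≟ᵇ D w x) ¬c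
    ... | w , yw≢wx with side w ≟ᵇ side x
    ... | yes e = contradiction (trans (arc-within (trans (sym s) (sym e))) (sym (arc-within e))) yw≢wx
    ... | no e with D y w in yw | D w x in wx
    ... | true  | true  = contradiction refl yw≢wx
    ... | false | false = contradiction refl yw≢wx
    ... | true  | false = x≢y , w , inj₁ (trans (arc-across (e ∘ sym)) (cong not wx) , yw)
    ... | false | true  = x≢y , w , inj₂ (wx , trans (arc-across (λ t → e (trans t (sym s)))) (cong not yw))

module Labelling {n : ℕ} {D : Digraph n} {side : Fin n → Bool}
                 (BT : IsBipartiteTournament D side) (Z : Subset n)
                 (Z-unique : ∀ z z' → z ∈ Z → z' ∈ Z → OutEquiv D z z' → z ≡ z') where
  open BipartiteTournament BT

  complement-unique-in-Z : ∀ {x y y'} → y ∈ Z → y' ∈ Z →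
                           Complement D x y → Complement D x y' → y ≡ y'
  complement-unique-in-Z yZ y'Z c c' = Z-unique _ _ yZ y'Z (complement-unique D c c')

  partner? : ∀ x → Dec (∃[ y ] y ∈ Z × Complement D x y)
  partner? x = any? (λ y → (y ∈? Z) ×-dec complement? D x y)

  label : Fin n → ℕ
  label x with partner? x
  ... | yes (y , _) = toℕ x ⊓ toℕ y
  ... | no _        = toℕ x

  label-spec : ∀ x → ∃[ c ] label x ≡ toℕ c × (c ≡ x ⊎ Complement D x c)
  label-spec x with partner? x
  ... | no _ = x , refl , inj₁ refl
  ... | yes (y , _ , c) with ⊓-sel (toℕ x) (toℕ y)
  ...   | inj₁ e = x , e , inj₁ refl
  ...   | inj₂ e = y , e , inj₂ c

  module _ {x y : Fin n} (xZ : x ∈ Z) (yZ : y ∈ Z) (s : side x ≡ side y) where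

    complement⇒label-eq : Complement D x y → label x ≡ label y
    complement⇒label-eq c with partner? x | partner? y
    ... | no ¬p | _ = contradiction (y , yZ , c) ¬p
    ... | yes _ | no ¬p = contradiction (x , xZ , complement-sym s c) ¬p
    ... | yes (y' , y'Z , c') | yes (x' , x'Z , c'')
        with complement-unique-in-Z yZ y'Z c c' | complement-unique-in-Z xZ x'Z (complement-sym s c) c''
    ... | refl | refl = ⊓-comm (toℕ x) (toℕ y)

    label-eq⇒complement : x ≢ y → label x ≡ label y → Complement D x y
    label-eq⇒complement x≢y e with label-spec x | label-spec y
    ... | c , lx , px | c' , ly , py with toℕ-injective (trans (sym lx) (trans e ly))
    ... | refl with px | py
    ... | inj₁ refl | inj₁ refl = contradiction refl x≢y
    ... | inj₁ refl | inj₂ cyx  = complement-sym (sym s) cyx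
    ... | inj₂ cxy  | inj₁ refl = cxy
    ... | inj₂ cxc  | inj₂ cyc  =
      contradiction (Z-unique x y xZ yZ (sameIn⇒outEquiv s (λ w → trans (sym (cxc w)) (cyc w)))) x≢y

lemma3p5 : (n : ℕ) (D : Digraph n) (side : Fin n → Bool) →
    IsBipartiteTournament D side →
    (Z : Subset n) → IsTransversal D Z →
    ∀ z₀ → z₀ ∈ Z →
    IsCompleteMultipartite≤2 (NicheAdj D) (λ x → x ∈ Z × Reach (NicheAdj D) Z z₀ x)
lemma3p5 n D side BT Z (_ , Z-unique) z₀ _ = label , adjacency , atMostTwo
  where
  open BipartiteTournament BT
  open Labelling BT Z Z-unique

  sameSide : ∀ {x y} → Reach (NicheAdj D) Z z₀ x → Reach (NicheAdj D) Z z₀ y → side x ≡ side y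
  sameSide rx ry = trans (reach⇒sameSide rx) (sym (reach⇒sameSide ry))

  adjacency : ∀ x y → x ∈ Z × Reach (NicheAdj D) Z z₀ x → y ∈ Z × Reach (NicheAdj D) Z z₀ y →
              x ≢ y → NicheAdj D x y ⇔ label x ≢ label y
  adjacency x y (xZ , rx) (yZ , ry) x≢y = mk⇔
    (λ adj e → complement⇒¬nicheAdj s (label-eq⇒complement xZ yZ s x≢y e) adj)
    (λ label≢ → ¬complement⇒nicheAdj s x≢y (label≢ ∘ complement⇒label-eq xZ yZ s))
    where s = sameSide rx ry

  atMostTwo : ∀ x y z → x ∈ Z × Reach (NicheAdj D) Z z₀ x → y ∈ Z × Reach (NicheAdj D) Z z₀ y →
              z ∈ Z × Reach (NicheAdj D) Z z₀ z → label x ≡ label y → label y ≡ label z →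
              x ≡ y ⊎ y ≡ z ⊎ x ≡ z
  atMostTwo x y z (xZ , rx) (yZ , ry) (zZ , rz) xy yz with x ≟ᶠ y | x ≟ᶠ z
  ... | yes x≡y | _       = inj₁ x≡y
  ... | no _    | yes x≡z = inj₂ (inj₂ x≡z)
  ... | no x≢y  | no x≢z  = inj₂ (inj₁ (complement-unique-in-Z yZ zZ
          (label-eq⇒complement xZ yZ (sameSide rx ry) x≢y xy)
          (label-eq⇒complement xZ zZ (sameSide rx rz) x≢z (trans xy yz))))
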